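{- Let $G$ be a finite unicyclic graph with cycle $x_1x_2x_3x_4x_1$ such that $\deg(x_1)\geqslant 3$ and $\deg(x_2)\geqslant 3$. If the connected component of $G-\{x_2,x_3,x_4\}$ containing $x_1$ contains an inner node $u$ (of $G$) with $d(u,x_1)=3k+1$ or $d(u,x_1)=3k+2$ for some integer $k\geqslant 0$, then $D_3(G)$ is connected.
   Context: A unicyclic graph is a connected graph containing exactly one cycle. The $3$-distance graph $D_3(G)$ has vertex set $V(G)$, two vertices being adjacent iff their distance in $G$ is exactly $3$. A vertex $u$ of $G$ is an inner node if $\deg(u)\geqslant 3$ and $u$ has at least two neighbours of degree at least $2$. -}

module Defs where

open import Data.Nat using (ℕ; zero; suc; _+_; _*_; _≤_; _<_)
open import Data.Fin using (Fin)
open import Data.List using (List; []; _∷_; _++_; length; filter)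
open import Data.List.Relation.Unary.Unique.Propositional using (Unique)
open import Data.List.Membership.Propositional using (_∈_)
open import Data.Product using (Σ; ∃; _×_; _,_)
open import Data.Sum using (_⊎_)
open import Data.Empty using (⊥)
open import Relation.Nullary using (¬_; Dec)
open import Relation.Binary.PropositionalEquality using (_≡_)
open import Relation.Binary.Construct.Closure.ReflexiveTransitive using (Star)
open import Data.List using (allFin)

record Graph (n : ℕ) : Set₁ where
  field
    Adj     : Fin n → Fin n → Set
    adj?    : (u v : Fin n) → Dec (Adj u v)
    sym     : ∀ {u v} → Adj u v → Adj v u
    irrefl  : ∀ {u} → ¬ Adj u u

module _ {n : ℕ} (G : Graph n) where
  open Graph G

  deg : Fin n → ℕ
  deg v = length (filter (adj? v) (allFin n))

  data Walk : Fin n → Fin n → ℕ → Set where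
    here : ∀ {u} → Walk u u 0
    step : ∀ {u v w k} → Adj u v → Walk v w k → Walk u w (suc k)

  Dist : Fin n → Fin n → ℕ → Set
  Dist u v d = Walk u v d × (∀ m → Walk u v m → d ≤ m)

  Connected : Set
  Connected = ∀ u v → Star Adj u v

  PathArc : List (Fin n) → Fin n → Fin n → Set
  PathArc []            u v = ⊥
  PathArc (a ∷ [])      u v = ⊥
  PathArc (a ∷ b ∷ rest) u v = (u ≡ a × v ≡ b) ⊎ PathArc (b ∷ rest) u v

  CycleArc : List (Fin n) → Fin n → Fin n → Set
  CycleArc []       u v = ⊥
  CycleArc (a ∷ as) u v = PathArc (a ∷ as ++ a ∷ []) u v

  CycleEdge : List (Fin n) → Fin n → Fin n → Set
  CycleEdge c u v = CycleArc c u v ⊎ CycleArc c v u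

  IsCycle : List (Fin n) → Set
  IsCycle c = Unique c × 3 ≤ length c × (∀ u v → CycleArc c u v → Adj u v)

  -- G is unicyclic and its unique cycle (as a subgraph, i.e. edge set) is c
  UnicyclicWithCycle : List (Fin n) → Set
  UnicyclicWithCycle c =
    Connected × IsCycle c ×
    (∀ c' → IsCycle c' → ∀ u v → (CycleEdge c' u v → CycleEdge c u v)
                                × (CycleEdge c u v → CycleEdge c' u v))

  InnerNode : Fin n → Set
  InnerNode u = 3 ≤ deg u ×
    Σ (Fin n) λ a → Σ (Fin n) λ b → ¬ a ≡ b × Adj u a × Adj u b × 2 ≤ deg a × 2 ≤ deg b

  AdjMinus : List (Fin n) → Fin n → Fin n → Set
  AdjMinus S u v = Adj u v × ¬ u ∈ S × ¬ v ∈ S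

  InComponentMinus : List (Fin n) → Fin n → Fin n → Set
  InComponentMinus S x u = ¬ x ∈ S × Star (AdjMinus S) x u

  D3Adj : Fin n → Fin n → Set
  D3Adj u v = Dist u v 3

  D3Connected : Set
  D3Connected = ∀ u v → Star D3Adj u v

-- Write v ≈ w when v and w lie in one component of D₃(G). Since C = x₁x₂x₃x₄ is the only cycle,
-- G has no triangles and no 5-cycles and every 4-cycle is C; hence a path a–b–c–d without
-- immediate reversals that is not contained in C has d(a, d) = 3. Along such walks ≈ therefore
-- propagates in steps of three, and vertices are determined up to ≈ by their position mod 3.
--
-- Let a, b be neighbours of degree ≥ 2 of the inner node u, with further neighbours a′, b′, and
-- let c be a third neighbour of u. The paths a′aub, a′auc, b′bua and b′buc put a, a′, b, b′ in one
-- class A. Prefixing a shortest u–x₁ path by t′, t (t ∈ {a, b}, t′ its outer neighbour) gives a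
-- chain whose end x₁ sits in position d(u, x₁) ≢ 0 (mod 3), i.e. in the class of t or t′: so
-- x₁ ∈ A. The walk from u to x₁ inside G − {x₂, x₃, x₄}, continued by x₄ or by x₂y with y an
-- off-cycle neighbour of x₂ (and d(y, x₄) = 3), forces u ∈ A whatever its length mod 3;
-- continuing it by x₂, x₂x₃ and x₄ puts all of C into A. Finally ≈ spreads from C along walks
-- leaving the cycle, since each new vertex is at distance 3 from a vertex three steps back.

module Submission where

open import Defs renaming (here to done)
open import Data.Nat using (ℕ; zero; suc; _+_; _*_; _≤_; _<_; z≤n; s≤s; s≤s⁻¹; _≤?_)
open import Data.Nat.Properties using (+-comm; +-suc; *-suc; n≤0⇒n≡0; m+1+n≢0; n≤1+n; +-cancelʳ-≤; ≤-antisym; <⇒≱; ≰⇒>)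
open import Data.Fin using (Fin; _≟_)
open import Data.List using (List; []; _∷_; _++_; length; filter; allFin)
open import Data.List.Properties using (length-++)
open import Data.List.Relation.Unary.Unique.Propositional using (Unique)
open import Data.List.Relation.Unary.Unique.Propositional.Properties using (filter⁺; allFin⁺)
open import Data.List.Relation.Unary.AllPairs using ([]; _∷_)
open import Data.List.Relation.Unary.All using ([]; _∷_) renaming (lookup to All-lookup)
open import Data.List.Relation.Unary.Any using (here; there; any?)
open import Data.List.Relation.Unary.Linked using (Linked; [-]; _∷_)
open import Data.List.Relation.Binary.Subset.Propositional using (_⊆_)
open import Data.List.Membership.Propositional using (_∈_; _∉_; find; lose)
open import Data.List.Membership.Propositional.Properties using (∈-∃++; ∈-++⁻; ∈-++⁺ˡ; ∈-++⁺ʳ; ∈-filter⁻)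
open import Data.Product using (Σ; ∃; _×_; _,_; proj₁; proj₂)
open import Data.Sum using (_⊎_; inj₁; inj₂)
open import Data.Empty using (⊥; ⊥-elim)
open import Data.Unit using (⊤; tt)
open import Function using (_∘_; case_of_)
open import Relation.Binary.Construct.Closure.ReflexiveTransitive using (Star; ε; _◅_; _◅◅_; reverse)
open import Relation.Nullary using (¬_; yes; no; ¬?; contradiction)
open import Relation.Nullary.Decidable using (decidable-stable)
open import Relation.Binary.Definitions using (DecidableEquality)
open import Relation.Binary.PropositionalEquality using (_≡_; _≢_; refl; sym; trans; cong; subst; subst₂)

module _ {A : Set} where

  Unique⇒length≤ : ∀ {xs ys : List A} → Unique xs → xs ⊆ ys → length xs ≤ length ys
  Unique⇒length≤ {[]} _ _ = z≤n
  Unique⇒length≤ {x ∷ xs} {ys} (x∉xs ∷ xs!) xs⊆ys with ∈-∃++ (xs⊆ys (here refl))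
  ... | ys₁ , ys₂ , refl =
    subst (suc (length xs) ≤_) (sym length-split) (s≤s (Unique⇒length≤ xs! xs⊆ys₁++ys₂))
    where
    xs⊆ys₁++ys₂ : xs ⊆ ys₁ ++ ys₂
    xs⊆ys₁++ys₂ y∈xs with ∈-++⁻ ys₁ (xs⊆ys (there y∈xs))
    ... | inj₁ y∈ys₁ = ∈-++⁺ˡ y∈ys₁
    ... | inj₂ (here refl) = ⊥-elim (All-lookup x∉xs y∈xs refl)
    ... | inj₂ (there y∈ys₂) = ∈-++⁺ʳ ys₁ y∈ys₂
    length-split : length (ys₁ ++ x ∷ ys₂) ≡ suc (length (ys₁ ++ ys₂))
    length-split rewrite length-++ ys₁ {x ∷ ys₂} | length-++ ys₁ {ys₂} =
      +-suc (length ys₁) (length ys₂)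

  lastOf : A → List A → A
  lastOf x [] = x
  lastOf x (y ∷ ys) = lastOf y ys

  lastOf-++ : ∀ x xs ys → lastOf x (xs ++ ys) ≡ lastOf (lastOf x xs) ys
  lastOf-++ x [] ys = refl
  lastOf-++ x (y ∷ xs) ys = lastOf-++ y xs ys

  Linked₃ : (A → A → Set) → List A → Set
  Linked₃ R (a ∷ b ∷ c ∷ d ∷ xs) = R a d × Linked₃ R (b ∷ c ∷ d ∷ xs)
  Linked₃ R _ = ⊤

  -- periodic₃ m a b c is the entry with index m + 2 of the sequence a, b, c, a, b, c, …
  periodic₃ : ℕ → A → A → A → A
  periodic₃ zero a b c = c
  periodic₃ (suc m) a b c = periodic₃ m b c a

  periodic₃-elim : ∀ (P : A → Set) m {a b c} → P a → P b → P c → P (periodic₃ m a b c)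
  periodic₃-elim P zero pa pb pc = pc
  periodic₃-elim P (suc m) pa pb pc = periodic₃-elim P m pb pc pa

  periodic₃-3*+ : ∀ k r {a b c} → periodic₃ (3 * k + r) a b c ≡ periodic₃ r a b c
  periodic₃-3*+ zero r = refl
  periodic₃-3*+ (suc k) r {a} {b} {c} =
    trans (cong (λ i → periodic₃ (i + r) a b c) (*-suc 3 k)) (periodic₃-3*+ k r)

  periodic₃-residue : ∀ m → (∀ {a b c} → periodic₃ m a b c ≡ c)
                          ⊎ (∀ {a b c} → periodic₃ m a b c ≡ a)
                          ⊎ (∀ {a b c} → periodic₃ m a b c ≡ b)
  periodic₃-residue zero = inj₁ refl
  periodic₃-residue (suc zero) = inj₂ (inj₁ refl)
  periodic₃-residue (suc (suc zero)) = inj₂ (inj₂ refl)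
  periodic₃-residue (suc (suc (suc m))) = periodic₃-residue m

module _ {A : Set} {R : A → A → Set} where

  periodic₃-cong : ∀ m {a b c a′ b′ c′} → Star R a a′ → Star R b b′ → Star R c c′ →
                   Star R (periodic₃ m a b c) (periodic₃ m a′ b′ c′)
  periodic₃-cong zero p q r = r
  periodic₃-cong (suc m) p q r = periodic₃-cong m q r p

  Linked₃⇒periodic₃ : ∀ a b c xs → Linked₃ R (a ∷ b ∷ c ∷ xs) →
                      Star R (periodic₃ (length xs) a b c) (lastOf c xs)
  Linked₃⇒periodic₃ a b c [] _ = ε
  Linked₃⇒periodic₃ a b c (d ∷ xs) (Rad , rest) =
    periodic₃-cong (length xs) ε ε (Rad ◅ ε) ◅◅ Linked₃⇒periodic₃ b c d xs rest

-- NBWalk p v: a walk from x to v that never immediately reverses an edge, with last edge p → v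
-- (p = v = x for the empty walk).
module NonBacktracking {V : Set} (_≟ᵥ_ : DecidableEquality V) {R : V → V → Set}
  (R-irrefl : ∀ {v} → ¬ R v v) (x : V) where

  data NBWalk : V → V → Set where
    start  : NBWalk x x
    extend : ∀ {p v c} → NBWalk p v → R v c → c ≢ p → NBWalk v c

  -- the vertices before the endpoint, in reverse order
  trace : ∀ {p v} → NBWalk p v → List V
  trace start = []
  trace (extend {v = v} s _ _) = v ∷ trace s

  lastOf-trace : ∀ {p v} (s : NBWalk p v) → lastOf v (trace s) ≡ x
  lastOf-trace start = refl
  lastOf-trace (extend s _ _) = lastOf-trace s

  continue : ∀ {p v t} → NBWalk p v → Star R v t → ∃ λ p′ → NBWalk p′ t
  continue s ε = _ , s
  continue {p} s (_◅_ {j = c} e rest) with c ≟ᵥ p | s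
  ... | yes refl | extend s′ _ _ = continue s′ rest
  ... | yes refl | start = ⊥-elim (R-irrefl e)
  ... | no c≢p | _ = continue (extend s e c≢p) rest

  nonBacktracking : ∀ {t} → Star R x t → ∃ λ p → NBWalk p t
  nonBacktracking = continue start

module GraphProperties {n : ℕ} (G : Graph n) where
  open Graph G renaming (sym to Adj-sym)
  open import Data.List.Membership.DecPropositional (_≟_ {n}) using (_∈?_)

  Adj⇒≢ : ∀ {a b} → Adj a b → a ≢ b
  Adj⇒≢ ab refl = irrefl ab

  Adj⇒≢ʳ : ∀ {a b} → Adj a b → b ≢ a
  Adj⇒≢ʳ ab = Adj⇒≢ (Adj-sym ab)

  walk-++ : ∀ {a b c i j} → Walk G a b i → Walk G b c j → Walk G a c (i + j)
  walk-++ done w = w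
  walk-++ (step e w) w′ = step e (walk-++ w w′)

  walk-reverse : ∀ {a b m} → Walk G a b m → Walk G b a m
  walk-reverse done = done
  walk-reverse {m = suc m} (step e w) =
    subst (Walk G _ _) (+-comm m 1) (walk-++ (walk-reverse w) (step (Adj-sym e) done))

  Dist-sym : ∀ {a b d} → Dist G a b d → Dist G b a d
  Dist-sym (w , shortest) = walk-reverse w , λ m w′ → shortest m (walk-reverse w′)

  Dist⇒≢ : ∀ {a b d} → Dist G a b d → d ≢ 0 → a ≢ b
  Dist⇒≢ (_ , shortest) d≢0 refl = d≢0 (n≤0⇒n≡0 (shortest 0 done))

  Star-AdjMinus-∉ : ∀ {S x v} → Star (AdjMinus G S) x v → x ∉ S → v ∉ S
  Star-AdjMinus-∉ ε x∉S = x∉S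
  Star-AdjMinus-∉ ((_ , _ , y∉S) ◅ rest) _ = Star-AdjMinus-∉ rest y∉S

  visits : ∀ {a b m} → Walk G a b m → List (Fin n)
  visits done = []
  visits (step {v = v} _ w) = v ∷ visits w

  length-visits : ∀ {a b m} (w : Walk G a b m) → length (visits w) ≡ m
  length-visits done = refl
  length-visits (step _ w) = cong suc (length-visits w)

  lastOf-visits : ∀ {a b m} (w : Walk G a b m) → lastOf a (visits w) ≡ b
  lastOf-visits done = refl
  lastOf-visits (step _ w) = lastOf-visits w

  short-walk : ∀ {a d m} → Walk G a d m → m < 3 →
               a ≡ d ⊎ Adj a d ⊎ ∃ λ z → Adj a z × Adj z d
  short-walk done _ = inj₁ refl
  short-walk (step e done) _ = inj₂ (inj₁ e)
  short-walk (step e (step e′ done)) _ = inj₂ (inj₂ (_ , e , e′))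
  short-walk (step _ (step _ (step _ _))) (s≤s (s≤s (s≤s ())))

  dist3-intro : ∀ {a d} → a ≢ d → ¬ Adj a d → (∀ z → Adj a z → Adj z d → ⊥) →
                Walk G a d 3 → Dist G a d 3
  dist3-intro a≢d ¬ad no-common w = w , shortest
    where
    shortest : ∀ m → Walk G _ _ m → 3 ≤ m
    shortest m w′ with 3 ≤? m
    ... | yes 3≤m = 3≤m
    ... | no 3≰m with short-walk w′ (≰⇒> 3≰m)
    ... | inj₁ a≡d = ⊥-elim (a≢d a≡d)
    ... | inj₂ (inj₁ ad) = ⊥-elim (¬ad ad)
    ... | inj₂ (inj₂ (z , az , zd)) = ⊥-elim (no-common z az zd)

  geodesic-Linked₃ : ∀ {a b m} (w : Walk G a b m) → (∀ m′ → Walk G a b m′ → m ≤ m′) →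
                     Linked₃ (D3Adj G) (a ∷ visits w)
  geodesic-Linked₃ done _ = tt
  geodesic-Linked₃ (step _ done) _ = tt
  geodesic-Linked₃ (step _ (step _ done)) _ = tt
  geodesic-Linked₃ {m = suc (suc (suc k))} (step e₁ (step e₂ (step e₃ w))) shortest =
    (step e₁ (step e₂ (step e₃ done)) ,
     λ m′ w′ → +-cancelʳ-≤ k 3 m′ (shortest (m′ + k) (walk-++ w′ w))) ,
    geodesic-Linked₃ (step e₂ (step e₃ w)) λ m′ w′ → s≤s⁻¹ (shortest (suc m′) (step e₁ w′))

  neighbour-outside : ∀ v (ys : List (Fin n)) → length ys < deg G v → ∃ λ w → Adj v w × w ∉ ys
  neighbour-outside v ys ys<deg with any? (λ w → ¬? (w ∈? ys)) (filter (adj? v) (allFin n))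
  ... | yes outside with find outside
  ...   | w , w∈N , w∉ys = w , proj₂ (∈-filter⁻ (adj? v) {xs = allFin n} w∈N) , w∉ys
  neighbour-outside v ys ys<deg | no none =
    contradiction (Unique⇒length≤ (filter⁺ (adj? v) (allFin⁺ n)) N⊆ys) (<⇒≱ ys<deg)
    where
    N⊆ys : filter (adj? v) (allFin n) ⊆ ys
    N⊆ys w∈N = decidable-stable (_ ∈? ys) (none ∘ lose w∈N)

  pathArc-∈ : ∀ (L : List (Fin n)) {u v} → PathArc G L u v → u ∈ L × v ∈ L
  pathArc-∈ (a ∷ b ∷ L) (inj₁ (refl , refl)) = here refl , there (here refl)
  pathArc-∈ (a ∷ b ∷ L) (inj₂ arc) with pathArc-∈ (b ∷ L) arc
  ... | u∈ , v∈ = there u∈ , there v∈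

  cycleArc-∈ : ∀ (L : List (Fin n)) {u v} → CycleArc G L u v → u ∈ L × v ∈ L
  cycleArc-∈ (a ∷ as) arc with pathArc-∈ (a ∷ as ++ a ∷ []) arc
  ... | u∈ , v∈ = unclose u∈ , unclose v∈
    where
    unclose : ∀ {w} → w ∈ a ∷ as ++ a ∷ [] → w ∈ a ∷ as
    unclose (here refl) = here refl
    unclose (there w∈) with ∈-++⁻ as w∈
    ... | inj₁ w∈as = there w∈as
    ... | inj₂ (here refl) = here refl

  cycleEdge-∈ : ∀ (L : List (Fin n)) {u v} → CycleEdge G L u v → u ∈ L
  cycleEdge-∈ L (inj₁ arc) = proj₁ (cycleArc-∈ L arc)
  cycleEdge-∈ L (inj₂ arc) = proj₂ (cycleArc-∈ L arc)

  ∈⇒pathArc : ∀ (xs : List (Fin n)) y {v} → v ∈ xs → ∃ λ w → PathArc G (xs ++ y ∷ []) v w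
  ∈⇒pathArc (x ∷ []) y (here refl) = y , inj₁ (refl , refl)
  ∈⇒pathArc (x ∷ x′ ∷ xs) y (here refl) = x′ , inj₁ (refl , refl)
  ∈⇒pathArc (x ∷ x′ ∷ xs) y (there v∈) with ∈⇒pathArc (x′ ∷ xs) y v∈
  ... | w , arc = w , inj₂ arc

  ∈⇒cycleArc : ∀ (L : List (Fin n)) {v} → v ∈ L → ∃ λ w → CycleArc G L v w
  ∈⇒cycleArc (a ∷ as) = ∈⇒pathArc (a ∷ as) a

  Linked⇒pathArc : ∀ {L u v} → Linked Adj L → PathArc G L u v → Adj u v
  Linked⇒pathArc (e ∷ _) (inj₁ (refl , refl)) = e
  Linked⇒pathArc (_ ∷ l) (inj₂ arc) = Linked⇒pathArc l arc

  closedWalk⇒IsCycle : ∀ {a as} → Unique (a ∷ as) → 3 ≤ length (a ∷ as) →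
                       Linked Adj (a ∷ as ++ a ∷ []) → IsCycle G (a ∷ as)
  closedWalk⇒IsCycle distinct long closed = distinct , long , λ _ _ → Linked⇒pathArc closed

  module Unicyclic {c : List (Fin n)} (uc : UnicyclicWithCycle G c) where

    IsCycle⇒⊆ : ∀ {c′} → IsCycle G c′ → c′ ⊆ c
    IsCycle⇒⊆ {c′} c′-cycle v∈c′ with ∈⇒cycleArc c′ v∈c′
    ... | w , arc = cycleEdge-∈ c (proj₁ (proj₂ (proj₂ uc) c′ c′-cycle _ w) (inj₁ arc))

    ⊆IsCycle : ∀ {c′} → IsCycle G c′ → c ⊆ c′
    ⊆IsCycle {c′} c′-cycle v∈c with ∈⇒cycleArc c v∈c
    ... | w , arc = cycleEdge-∈ c′ (proj₂ (proj₂ (proj₂ uc) c′ c′-cycle _ w) (inj₁ arc))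

    IsCycle⇒length≡ : ∀ {c′} → IsCycle G c′ → length c′ ≡ length c
    IsCycle⇒length≡ c′-cycle =
      ≤-antisym (Unique⇒length≤ (proj₁ c′-cycle) (IsCycle⇒⊆ c′-cycle))
                (Unique⇒length≤ (proj₁ (proj₁ (proj₂ uc))) (⊆IsCycle c′-cycle))

module FourCycle {n : ℕ} (G : Graph n) (x₁ x₂ x₃ x₄ : Fin n)
  (uc : UnicyclicWithCycle G (x₁ ∷ x₂ ∷ x₃ ∷ x₄ ∷ [])) where
  open Graph G renaming (sym to Adj-sym)
  open GraphProperties G
  open Unicyclic uc

  C : List (Fin n)
  C = x₁ ∷ x₂ ∷ x₃ ∷ x₄ ∷ []

  x₂∈C : x₂ ∈ C
  x₂∈C = there (here refl)

  x₃∈C : x₃ ∈ C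
  x₃∈C = there (there (here refl))

  x₄∈C : x₄ ∈ C
  x₄∈C = there (there (there (here refl)))

  C-arc : ∀ u v → CycleArc G C u v → Adj u v
  C-arc = proj₂ (proj₂ (proj₁ (proj₂ uc)))

  x₁x₂ : Adj x₁ x₂
  x₁x₂ = C-arc _ _ (inj₁ (refl , refl))

  x₂x₃ : Adj x₂ x₃
  x₂x₃ = C-arc _ _ (inj₂ (inj₁ (refl , refl)))

  x₃x₄ : Adj x₃ x₄
  x₃x₄ = C-arc _ _ (inj₂ (inj₂ (inj₁ (refl , refl))))

  x₄x₁ : Adj x₄ x₁
  x₄x₁ = C-arc _ _ (inj₂ (inj₂ (inj₂ (inj₁ (refl , refl)))))

  x₁≢x₃ : x₁ ≢ x₃
  x₁≢x₃ with proj₁ (proj₁ (proj₂ uc))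
  ... | (_ ∷ x₁≢x₃ ∷ _) ∷ _ = x₁≢x₃

  x₂≢x₄ : x₂ ≢ x₄
  x₂≢x₄ with proj₁ (proj₁ (proj₂ uc))
  ... | _ ∷ (_ ∷ x₂≢x₄ ∷ _) ∷ _ = x₂≢x₄

  no-triangle : ∀ {a b c} → Adj a b → Adj b c → Adj c a → ⊥
  no-triangle ab bc ca = case IsCycle⇒length≡ triangle of λ ()
    where
    triangle : IsCycle G (_ ∷ _ ∷ _ ∷ [])
    triangle = closedWalk⇒IsCycle
      ((Adj⇒≢ ab ∷ Adj⇒≢ʳ ca ∷ []) ∷ (Adj⇒≢ bc ∷ []) ∷ [] ∷ [])
      (s≤s (s≤s (s≤s z≤n))) (ab ∷ bc ∷ ca ∷ [-])

  -- In a triangle-free graph a closed walk of length 5 is a 5-cycle, and C is the only cycle.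
  no-pentagon : ∀ {a b c d e} → Adj a b → Adj b c → Adj c d → Adj d e → Adj e a → ⊥
  no-pentagon ab bc cd de ea = case IsCycle⇒length≡ pentagon of λ ()
    where
    pentagon : IsCycle G (_ ∷ _ ∷ _ ∷ _ ∷ _ ∷ [])
    pentagon = closedWalk⇒IsCycle
      ((Adj⇒≢ ab ∷ (λ { refl → no-triangle cd de ea }) ∷ (λ { refl → no-triangle ab bc cd })
                 ∷ Adj⇒≢ʳ ea ∷ []) ∷
       (Adj⇒≢ bc ∷ (λ { refl → no-triangle de ea ab }) ∷ (λ { refl → no-triangle bc cd de }) ∷ []) ∷
       (Adj⇒≢ cd ∷ (λ { refl → no-triangle ea ab bc }) ∷ []) ∷
       (Adj⇒≢ de ∷ []) ∷ [] ∷ [])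
      (s≤s (s≤s (s≤s z≤n))) (ab ∷ bc ∷ cd ∷ de ∷ ea ∷ [-])

  square⊆C : ∀ {a b c d} → Adj a b → Adj b c → Adj c d → Adj d a → a ≢ c → b ≢ d →
             a ∈ C × b ∈ C × c ∈ C × d ∈ C
  square⊆C ab bc cd da a≢c b≢d =
    ⊆C (here refl) , ⊆C (there (here refl)) , ⊆C (there (there (here refl))) ,
    ⊆C (there (there (there (here refl))))
    where
    ⊆C : _ ⊆ C
    ⊆C = IsCycle⇒⊆ (closedWalk⇒IsCycle
      ((Adj⇒≢ ab ∷ a≢c ∷ Adj⇒≢ʳ da ∷ []) ∷ (Adj⇒≢ bc ∷ b≢d ∷ []) ∷ (Adj⇒≢ cd ∷ []) ∷ [] ∷ [])
      (s≤s (s≤s (s≤s z≤n))) (ab ∷ bc ∷ cd ∷ da ∷ [-]))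

  path-dist3 : ∀ {a b c d} → Adj a b → Adj b c → Adj c d → a ≢ c → b ≢ d →
               D3Adj G a d ⊎ (a ∈ C × b ∈ C × c ∈ C × d ∈ C)
  path-dist3 {a} {d = d} ab bc cd a≢c b≢d with adj? a d
  ... | yes ad = inj₂ (square⊆C ab bc cd (Adj-sym ad) a≢c b≢d)
  ... | no ¬ad = inj₁ (dist3-intro (λ { refl → no-triangle ab bc cd }) ¬ad
                         (λ z az zd → no-pentagon ab bc cd (Adj-sym zd) (Adj-sym az))
                         (step ab (step bc (step cd done))))

  off-cycle-dist3 : ∀ {a b c d} → Adj a b → Adj b c → Adj c d → a ≢ c → b ≢ d →
                    ¬ (a ∈ C × b ∈ C × c ∈ C × d ∈ C) → D3Adj G a d
  off-cycle-dist3 ab bc cd a≢c b≢d off with path-dist3 ab bc cd a≢c b≢d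
  ... | inj₁ ad = ad
  ... | inj₂ on = ⊥-elim (off on)

  infix 4 _≈_
  _≈_ : Fin n → Fin n → Set
  _≈_ = Star (D3Adj G)

  ≈-sym : ∀ {a b} → a ≈ b → b ≈ a
  ≈-sym = reverse Dist-sym

  module Spread (C≈x₁ : ∀ {v} → v ∈ C → v ≈ x₁) where
    open NonBacktracking (_≟_ {n}) {Adj} irrefl x₁

    -- The anchor lets a walk continuing past v reach a vertex ≈ x₁ three steps back.
    record Anchored (p v : Fin n) : Set where
      field
        p≈x₁ : p ≈ x₁
        v≈x₁ : v ≈ x₁
        anchor : Fin n
        p-anchor : Adj p anchor
        anchor≢v : anchor ≢ v
        anchor≈x₁ : anchor ≈ x₁

    ≈x₁-by-path₃ : ∀ {c v y z} → Adj c v → Adj v y → Adj y z → c ≢ y → v ≢ z → z ≈ x₁ → c ≈ x₁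
    ≈x₁-by-path₃ cv vy yz c≢y v≢z z≈x₁ with path-dist3 cv vy yz c≢y v≢z
    ... | inj₁ cz = cz ◅ z≈x₁
    ... | inj₂ (c∈C , _) = C≈x₁ c∈C

    leave-x₁ : ∀ {c} → Adj x₁ c → Anchored x₁ c
    leave-x₁ {c} x₁c with c ≟ x₂
    ... | yes refl = record
      { p≈x₁ = ε ; v≈x₁ = C≈x₁ x₂∈C ; anchor = x₄ ; p-anchor = Adj-sym x₄x₁
      ; anchor≢v = x₂≢x₄ ∘ sym ; anchor≈x₁ = C≈x₁ x₄∈C }
    ... | no c≢x₂ = record
      { p≈x₁ = ε ; v≈x₁ = ≈x₁-by-path₃ (Adj-sym x₁c) x₁x₂ x₂x₃ c≢x₂ x₁≢x₃ (C≈x₁ x₃∈C)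
      ; anchor = x₂ ; p-anchor = x₁x₂ ; anchor≢v = c≢x₂ ∘ sym ; anchor≈x₁ = C≈x₁ x₂∈C }

    step-anchored : ∀ {p v c} → Anchored p v → Adj p v → Adj v c → c ≢ p → Anchored v c
    step-anchored A pv vc c≢p = record
      { p≈x₁ = v≈x₁
      ; v≈x₁ = ≈x₁-by-path₃ (Adj-sym vc) (Adj-sym pv) p-anchor c≢p (anchor≢v ∘ sym) anchor≈x₁
      ; anchor = _ ; p-anchor = Adj-sym pv ; anchor≢v = c≢p ∘ sym ; anchor≈x₁ = p≈x₁ }
      where open Anchored A

    last-anchored : ∀ {p v c} → NBWalk p v → Adj v c → c ≢ p → Anchored v c
    last-anchored start x₁c _ = leave-x₁ x₁c
    last-anchored (extend s pv v≢q) vc c≢p = step-anchored (last-anchored s pv v≢q) pv vc c≢p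

    spread : ∀ {p v} → NBWalk p v → v ≈ x₁
    spread start = ε
    spread (extend s vc c≢p) = Anchored.v≈x₁ (last-anchored s vc c≢p)

    Connected⇒≈x₁ : Connected G → ∀ v → v ≈ x₁
    Connected⇒≈x₁ connected v = spread (proj₂ (nonBacktracking (connected x₁ v)))

  D3Connected-from-cycle : Connected G → (∀ {v} → v ∈ C → v ≈ x₁) → D3Connected G
  D3Connected-from-cycle connected C≈x₁ u v = ≈x₁ u ◅◅ ≈-sym (≈x₁ v)
    where
    ≈x₁ : ∀ v → v ≈ x₁
    ≈x₁ = Spread.Connected⇒≈x₁ C≈x₁ connected

  S : List (Fin n)
  S = x₂ ∷ x₃ ∷ x₄ ∷ []

  x₁∉S : x₁ ∉ S
  x₁∉S (here x₁≡x₂) = Adj⇒≢ x₁x₂ x₁≡x₂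
  x₁∉S (there (here x₁≡x₃)) = x₁≢x₃ x₁≡x₃
  x₁∉S (there (there (here x₁≡x₄))) = Adj⇒≢ʳ x₄x₁ x₁≡x₄

  ∉S-∈C⇒≡x₁ : ∀ {v} → v ∉ S → v ∈ C → v ≡ x₁
  ∉S-∈C⇒≡x₁ _ (here v≡x₁) = v≡x₁
  ∉S-∈C⇒≡x₁ v∉S (there v∈S) = ⊥-elim (v∉S v∈S)

  ∉S⇒∉C : ∀ {v} → v ∉ S → v ≢ x₁ → v ∉ C
  ∉S⇒∉C v∉S v≢x₁ = v≢x₁ ∘ ∉S-∈C⇒≡x₁ v∉S

  open NonBacktracking (_≟_ {n}) {AdjMinus G S} (irrefl ∘ proj₁) x₁

  Ending : List (Fin n) → Set
  Ending es = ∀ {a b} → Adj a b → Adj b x₁ → a ≢ x₁ → b ∉ C → Linked₃ (D3Adj G) (a ∷ b ∷ x₁ ∷ es)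

  ending₀ : Ending []
  ending₀ _ _ _ _ = tt

  ending₁ : ∀ {e} → Adj x₁ e → e ∈ C → Ending (e ∷ [])
  ending₁ x₁e e∈C ab bx₁ a≢x₁ b∉C =
    off-cycle-dist3 ab bx₁ x₁e a≢x₁ (λ { refl → b∉C e∈C }) (λ (_ , b∈C , _) → b∉C b∈C) , tt

  ending₂ : ∀ {e f} → Adj x₁ e → e ∈ C → Adj e f → x₁ ≢ f → Ending (e ∷ f ∷ [])
  ending₂ x₁e e∈C ef x₁≢f ab bx₁ a≢x₁ b∉C =
    proj₁ (ending₁ x₁e e∈C ab bx₁ a≢x₁ b∉C) ,
    off-cycle-dist3 bx₁ x₁e ef (λ { refl → b∉C e∈C }) x₁≢f (λ (b∈C , _) → b∉C b∈C) , tt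

  -- Each window of four consecutive vertices contains two adjacent vertices outside S,
  -- and they cannot both lie on C.
  trail-Linked₃ : ∀ {a b p v es} (s : NBWalk p v) → Adj a b → Adj b v → a ≢ v → b ≢ p →
                  (v ≡ x₁ → b ∉ S) → Ending es → Linked₃ (D3Adj G) (a ∷ b ∷ v ∷ trace s ++ es)
  trail-Linked₃ start ab bx₁ a≢x₁ b≢x₁ b∉S ending = ending ab bx₁ a≢x₁ (∉S⇒∉C (b∉S refl) b≢x₁)
  trail-Linked₃ (extend s (pv , p∉S , v∉S) v≢q) ab bv a≢v b≢p _ ending =
    off-cycle-dist3 ab bv (Adj-sym pv) a≢v b≢p
      (λ (_ , _ , v∈C , p∈C) → Adj⇒≢ʳ pv (trans (∉S-∈C⇒≡x₁ v∉S v∈C) (sym (∉S-∈C⇒≡x₁ p∉S p∈C)))) ,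
    trail-Linked₃ s bv (Adj-sym pv) b≢p v≢q (λ _ → v∉S) ending

  module ThroughInnerNode (deg-x₂ : 3 ≤ deg G x₂) {u a b : Fin n}
    (x₁⇝u : Star (AdjMinus G S) x₁ u)
    (deg-u : 3 ≤ deg G u) (a≢b : a ≢ b) (ua : Adj u a) (ub : Adj u b)
    (deg-a : 2 ≤ deg G a) (deg-b : 2 ≤ deg G b)
    (dist : Σ ℕ λ k → Dist G u x₁ (3 * k + 1) ⊎ Dist G u x₁ (3 * k + 2)) where

    u≢x₁ : u ≢ x₁
    u≢x₁ = case dist of λ
      { (k , inj₁ d) → Dist⇒≢ d (m+1+n≢0 (3 * k))
      ; (k , inj₂ d) → Dist⇒≢ d (m+1+n≢0 (3 * k)) }

    u∉C : u ∉ C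
    u∉C = ∉S⇒∉C (Star-AdjMinus-∉ x₁⇝u x₁∉S) u≢x₁

    p : Fin n
    p = proj₁ (nonBacktracking x₁⇝u)

    trail : NBWalk p u
    trail = proj₂ (nonBacktracking x₁⇝u)

    through-u : ∀ {v w z} → Adj v w → Adj w u → Adj u z → v ≢ u → w ≢ z → D3Adj G v z
    through-u vw wu uz v≢u w≢z = off-cycle-dist3 vw wu uz v≢u w≢z (λ (_ , _ , u∈C , _) → u∉C u∈C)

    -- With a third neighbour c of u, the paths a′–a–u–c, b′–b–u–c, b′–b–u–a and a′–a–u–b
    -- realise distance 3.
    outer-≈ : ∀ {a′ b′} → Adj a a′ → a′ ≢ u → Adj b b′ → b′ ≢ u → a′ ≈ a × b ≈ a × b′ ≈ a
    outer-≈ aa′ a′≢u bb′ b′≢u with neighbour-outside u (a ∷ b ∷ []) deg-u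
    ... | c , uc , c∉ab = a′≈a , ≈-sym (a′b ◅ ε) ◅◅ a′≈a , b′a ◅ ε
      where
      a′c : D3Adj G _ c
      a′c = through-u (Adj-sym aa′) (Adj-sym ua) uc a′≢u (λ { refl → c∉ab (here refl) })
      b′c : D3Adj G _ c
      b′c = through-u (Adj-sym bb′) (Adj-sym ub) uc b′≢u (λ { refl → c∉ab (there (here refl)) })
      b′a : D3Adj G _ a
      b′a = through-u (Adj-sym bb′) (Adj-sym ub) ua b′≢u (a≢b ∘ sym)
      a′b : D3Adj G _ b
      a′b = through-u (Adj-sym aa′) (Adj-sym ua) ub a′≢u a≢b
      a′≈a : _ ≈ a
      a′≈a = a′c ◅ ≈-sym (b′c ◅ ε) ◅◅ b′a ◅ ε

    record Prong (r : Fin n) : Set where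
      field
        near far : Fin n
        u-near : Adj u near
        near≢r : near ≢ r
        near-far : Adj near far
        far≢u : far ≢ u
        near≈a : near ≈ a
        far≈a : far ≈ a

    prong : ∀ r → Prong r
    prong r with neighbour-outside a (u ∷ []) deg-a | neighbour-outside b (u ∷ []) deg-b
    ... | a′ , aa′ , a′∉u | b′ , bb′ , b′∉u
        with outer-≈ aa′ (a′∉u ∘ here) bb′ (b′∉u ∘ here) | a ≟ r
    ... | a′≈a , _ , _ | no a≢r = record
      { near = a ; far = a′ ; u-near = ua ; near≢r = a≢r ; near-far = aa′ ; far≢u = a′∉u ∘ here
      ; near≈a = ε ; far≈a = a′≈a }
    ... | _ , b≈a , b′≈a | yes refl = record
      { near = b ; far = b′ ; u-near = ub ; near≢r = a≢b ∘ sym ; near-far = bb′ ; far≢u = b′∉u ∘ here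
      ; near≈a = b≈a ; far≈a = b′≈a }

    geodesic-periodic₃ : ∀ {z m} (w : Walk G u z m) → (∀ m′ → Walk G u z m′ → m ≤ m′) →
                         ∃ λ r → periodic₃ m (Prong.far (prong r)) (Prong.near (prong r)) u ≈ z
    geodesic-periodic₃ done _ = u , ε
    geodesic-periodic₃ w@(step {v = q} uq rest) shortest =
      q , subst₂ _≈_ (cong (λ i → periodic₃ i far near u) (length-visits w)) (lastOf-visits w)
                     (Linked₃⇒periodic₃ far near u (visits w) (chain rest shortest))
      where
      open Prong (prong q)
      first : D3Adj G far q
      first = through-u (Adj-sym near-far) (Adj-sym u-near) uq far≢u near≢r
      chain : ∀ {z m} (rest : Walk G q z m) → (∀ m′ → Walk G u z m′ → suc m ≤ m′) →
              Linked₃ (D3Adj G) (far ∷ near ∷ u ∷ visits (step uq rest))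
      chain done _ = first , tt
      chain (step qq′ rest′) shortest =
        first ,
        off-cycle-dist3 (Adj-sym u-near) uq qq′ near≢r u≢q′ (λ (_ , u∈C , _) → u∉C u∈C) ,
        geodesic-Linked₃ (step uq (step qq′ rest′)) shortest
        where
        u≢q′ : u ≢ _
        u≢q′ refl = <⇒≱ (n≤1+n _) (shortest _ rest′)

    x₁≈a : x₁ ≈ a
    x₁≈a = case dist of λ
      { (k , inj₁ (w , shortest)) → let r , far≈x₁ = geodesic-periodic₃ w shortest in
          ≈-sym (subst (_≈ x₁) (periodic₃-3*+ k 1) far≈x₁) ◅◅ Prong.far≈a (prong r)
      ; (k , inj₂ (w , shortest)) → let r , near≈x₁ = geodesic-periodic₃ w shortest in
          ≈-sym (subst (_≈ x₁) (periodic₃-3*+ k 2) near≈x₁) ◅◅ Prong.near≈a (prong r) }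

    open Prong (prong p)

    trail-periodic₃ : ∀ es → Ending es →
                      periodic₃ (length es + length (trace trail)) far near u ≈ lastOf x₁ es
    trail-periodic₃ es ending =
      subst₂ _≈_ (cong (λ i → periodic₃ i far near u) length≡) lastOf≡
        (Linked₃⇒periodic₃ far near u (trace trail ++ es)
          (trail-Linked₃ trail (Adj-sym near-far) (Adj-sym u-near) far≢u near≢r
                         (λ u≡x₁ → ⊥-elim (u∉C (here u≡x₁))) ending))
      where
      length≡ : length (trace trail ++ es) ≡ length es + length (trace trail)
      length≡ = trans (length-++ (trace trail)) (+-comm (length (trace trail)) (length es))
      lastOf≡ : lastOf u (trace trail ++ es) ≡ lastOf x₁ es
      lastOf≡ = trans (lastOf-++ u (trace trail) es) (cong (λ v → lastOf v es) (lastOf-trace trail))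

    -- The endings x₄ and x₂y, with y a neighbour of x₂ off C (so d(y, x₄) = 3), tie the residue
    -- classes of the trail length together.
    u≈a : u ≈ a
    u≈a with neighbour-outside x₂ (x₁ ∷ x₃ ∷ []) deg-x₂
    ... | y , x₂y , y∉x₁x₃ = by-residue (periodic₃-residue (length (trace trail)))
      where
      y∉C : y ∉ C
      y∉C (here y≡x₁) = y∉x₁x₃ (here y≡x₁)
      y∉C (there (here y≡x₂)) = Adj⇒≢ʳ x₂y y≡x₂
      y∉C (there (there (here y≡x₃))) = y∉x₁x₃ (there (here y≡x₃))
      y∉C (there (there (there (here y≡x₄)))) =
        no-triangle x₂x₃ x₃x₄ (Adj-sym (subst (Adj x₂) y≡x₄ x₂y))
      y≈x₄ : y ≈ x₄
      y≈x₄ = off-cycle-dist3 (Adj-sym x₂y) x₂x₃ x₃x₄ (y∉x₁x₃ ∘ there ∘ here) x₂≢x₄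
                             (λ (y∈C , _) → y∉C y∈C) ◅ ε
      L : ℕ
      L = length (trace trail)
      τ₁ : periodic₃ (1 + L) far near u ≈ x₄
      τ₁ = trail-periodic₃ (x₄ ∷ []) (ending₁ (Adj-sym x₄x₁) x₄∈C)
      τ₂ : periodic₃ (2 + L) far near u ≈ y
      τ₂ = trail-periodic₃ (x₂ ∷ y ∷ []) (ending₂ x₁x₂ x₂∈C x₂y (y∉x₁x₃ ∘ here ∘ sym))
      by-residue : (∀ {x y z} → periodic₃ L x y z ≡ z) ⊎ (∀ {x y z} → periodic₃ L x y z ≡ x)
                   ⊎ (∀ {x y z} → periodic₃ L x y z ≡ y) → u ≈ a
      by-residue (inj₁ ≡c) = subst (_≈ x₁) ≡c (trail-periodic₃ [] ending₀) ◅◅ x₁≈a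
      by-residue (inj₂ (inj₁ ≡a)) =
        subst (_≈ y) ≡a τ₂ ◅◅ y≈x₄ ◅◅ ≈-sym (subst (_≈ x₄) ≡a τ₁) ◅◅ near≈a
      by-residue (inj₂ (inj₂ ≡b)) =
        subst (_≈ x₄) ≡b τ₁ ◅◅ ≈-sym y≈x₄ ◅◅ ≈-sym (subst (_≈ y) ≡b τ₂) ◅◅ far≈a

    ending-≈x₁ : ∀ es → Ending es → lastOf x₁ es ≈ x₁
    ending-≈x₁ es ending =
      ≈-sym (trail-periodic₃ es ending) ◅◅
      periodic₃-elim (_≈ a) (length es + length (trace trail)) far≈a near≈a u≈a ◅◅ ≈-sym x₁≈a

    C≈x₁ : ∀ {v} → v ∈ C → v ≈ x₁
    C≈x₁ (here refl) = ε
    C≈x₁ (there (here refl)) =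
      ending-≈x₁ (x₂ ∷ []) (ending₁ x₁x₂ x₂∈C)
    C≈x₁ (there (there (here refl))) =
      ending-≈x₁ (x₂ ∷ x₃ ∷ []) (ending₂ x₁x₂ x₂∈C x₂x₃ x₁≢x₃)
    C≈x₁ (there (there (there (here refl)))) =
      ending-≈x₁ (x₄ ∷ []) (ending₁ (Adj-sym x₄x₁) x₄∈C)

lemma2p14 : (n : ℕ) (G : Graph n) (x₁ x₂ x₃ x₄ : Fin n) →
    UnicyclicWithCycle G (x₁ ∷ x₂ ∷ x₃ ∷ x₄ ∷ []) →
    3 ≤ deg G x₁ → 3 ≤ deg G x₂ →
    (Σ (Fin n) λ u → InComponentMinus G (x₂ ∷ x₃ ∷ x₄ ∷ []) x₁ u × InnerNode G u ×
      Σ ℕ λ k → Dist G u x₁ (3 * k + 1) ⊎ Dist G u x₁ (3 * k + 2)) →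
    D3Connected G
lemma2p14 n G x₁ x₂ x₃ x₄ uc _ deg-x₂
  (u , (_ , x₁⇝u) , (deg-u , a , b , a≢b , ua , ub , deg-a , deg-b) , dist) =
  D3Connected-from-cycle (proj₁ uc) C≈x₁
  where
  open FourCycle G x₁ x₂ x₃ x₄ uc
  open ThroughInnerNode deg-x₂ x₁⇝u deg-u a≢b ua ub deg-a deg-b dist
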